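{- Let $n$ be a positive integer, $R$ a commutative ring, $u_{i,j}\in R$ for each $i\in[n]$ and $j\in[n+1]$, and $p_1,\ldots,p_n\in R$. Then $$\sum_{k=1}^n\det\left(u_{i,\,j+[k=i]}-p_i\,u_{i,j}\,[k=i]\right)_{i,j\in[n]}=\det\left(u_{i,\,j+[n=j]}\right)_{i,j\in[n]}-\Big(\sum_{k=1}^np_k\Big)\det\left(u_{i,j}\right)_{i,j\in[n]}.$$
   Context: $[m]=\{1,\ldots,m\}$. $[X]$ is the Iverson bracket ($1$ if $X$ is true, $0$ otherwise). $(a_{i,j})_{i,j\in[n]}$ is the $n\times n$ matrix with $(i,j)$-entry $a_{i,j}$. -}

module Defs where

open import Level using (Level)
open import Data.Nat using (ℕ; zero; suc)
open import Data.Fin using (Fin; zero; suc; punchIn)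
open import Data.Bool using (Bool; true; false; if_then_else_)
open import Relation.Nullary.Decidable using (does)
open import Algebra.Bundles using (CommutativeRing)
import Data.Fin as F

_=ᶠ_ : ∀ {n} → Fin n → Fin n → Bool
i =ᶠ j = does (i F.≟ j)

module _ {c ℓ : Level} (R : CommutativeRing c ℓ) where
  open CommutativeRing R using (Carrier; 0#; 1#; _+_; _-_; _*_)

  ∑ : ∀ {n} → (Fin n → Carrier) → Carrier
  ∑ {zero} f = 0#
  ∑ {suc n} f = f zero + ∑ (λ i → f (suc i))

  ∑alt : ∀ {n} → (Fin n → Carrier) → Carrier
  ∑alt {zero} f = 0#
  ∑alt {suc n} f = f zero - ∑alt (λ i → f (suc i))

  ⟦_⟧ : Bool → Carrier
  ⟦ true ⟧ = 1#
  ⟦ false ⟧ = 0#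

  det : ∀ {n} → (Fin n → Fin n → Carrier) → Carrier
  det {zero} M = 1#
  det {suc n} M = ∑alt (λ j → M zero j * det (λ i k → M (suc i) (punchIn j k)))

-- Write U and U′ for the n × n matrices formed by the first and by the last n
-- columns of u. By linearity of det in row k, the k-th summand on the left is
-- det(U with row k taken from U′) − p_k det U. Summing these row replacements over k
-- gives the same as summing the column replacements over l: both are the coefficient
-- of t in det(U + tU′). For l < n, column l of U′ equals column l + 1 of U, so those
-- determinants vanish, and the remaining one, l = n, is the determinant on the right.

module Submission where

open import Defs
open import Level using (Level)
open import Data.Nat using (ℕ; suc)
open import Data.Fin using (Fin; suc; inject₁; fromℕ)
open import Data.Bool using (if_then_else_)
open import Algebra.Bundles using (CommutativeRing)

open import Data.Bool using (true; false)
open import Data.Bool.Properties using (if-eta; if-float)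
open import Data.Empty using (⊥-elim)
open import Data.Fin using (zero; punchIn)
import Data.Fin as F
open import Data.Fin.Properties using (punchIn-injective; punchInᵢ≢i; suc-injective)
open import Data.Product using (Σ-syntax; _×_; _,_)
open import Data.Sum using (_⊎_; inj₁; inj₂)
open import Function using (_∘_)
open import Relation.Nullary.Decidable using (proof; dec-true; dec-false; yes; no)
open import Relation.Nullary.Reflects using (ofʸ; ofⁿ)
import Relation.Binary.PropositionalEquality as ≡
open ≡ using (_≡_; _≢_)

=ᶠ-refl : ∀ {n} (i : Fin n) → (i =ᶠ i) ≡ true
=ᶠ-refl i = dec-true (i F.≟ i) ≡.refl

=ᶠ-≢ : ∀ {n} {i j : Fin n} → i ≢ j → (i =ᶠ j) ≡ false
=ᶠ-≢ {i = i} {j} = dec-false (i F.≟ j)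

punchIn-=ᶠ : ∀ {n} (i : Fin (suc n)) (j k : Fin n) → (punchIn i j =ᶠ punchIn i k) ≡ (j =ᶠ k)
punchIn-=ᶠ i j k with j F.≟ k
... | yes j≡k = dec-true (punchIn i j F.≟ punchIn i k) (≡.cong (punchIn i) j≡k)
... | no j≢k = dec-false (punchIn i j F.≟ punchIn i k) (j≢k ∘ punchIn-injective i j k)

inject₁≢suc : ∀ {n} (i : Fin n) → inject₁ i ≢ suc i
inject₁≢suc zero ()
inject₁≢suc (suc i) = inject₁≢suc i ∘ suc-injective

punchIn-inject₁-suc : ∀ {n} (a k : Fin n) →
  punchIn (inject₁ a) k ≡ punchIn (suc a) k ⊎
  (punchIn (inject₁ a) k ≡ suc a × punchIn (suc a) k ≡ inject₁ a)
punchIn-inject₁-suc zero zero = inj₂ (≡.refl , ≡.refl)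
punchIn-inject₁-suc zero (suc k) = inj₁ ≡.refl
punchIn-inject₁-suc (suc a) zero = inj₁ ≡.refl
punchIn-inject₁-suc (suc a) (suc k) with punchIn-inject₁-suc a k
... | inj₁ eq = inj₁ (≡.cong suc eq)
... | inj₂ (eq₁ , eq₂) = inj₂ (≡.cong suc eq₁ , ≡.cong suc eq₂)

punchIn-adjacent-preimage : ∀ {n} (a : Fin (suc n)) (j : Fin (suc (suc n))) →
  j ≢ inject₁ a → j ≢ suc a →
  Σ[ b ∈ Fin n ] (punchIn j (inject₁ b) ≡ inject₁ a × punchIn j (suc b) ≡ suc a)
punchIn-adjacent-preimage zero zero j≢a _ = ⊥-elim (j≢a ≡.refl)
punchIn-adjacent-preimage zero (suc zero) _ j≢a+1 = ⊥-elim (j≢a+1 ≡.refl)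
punchIn-adjacent-preimage {suc n} zero (suc (suc j)) _ _ = zero , ≡.refl , ≡.refl
punchIn-adjacent-preimage (suc a) zero _ _ = a , ≡.refl , ≡.refl
punchIn-adjacent-preimage {suc n} (suc a) (suc j) j≢a j≢a+1
  with punchIn-adjacent-preimage a j (j≢a ∘ ≡.cong suc) (j≢a+1 ∘ ≡.cong suc)
... | b , eq₁ , eq₂ = suc b , ≡.cong suc eq₁ , ≡.cong suc eq₂

module _ {c ℓ : Level} (R : CommutativeRing c ℓ) where
  open CommutativeRing R hiding (zero)
  open import Algebra.Properties.Ring ring using (-0#≈0#; -‿+-comm; -‿distribˡ-*; x[y-z]≈xy-xz)
  open import Algebra.Properties.CommutativeSemigroup +-commutativeSemigroup
    using () renaming (interchange to +-interchange)
  open import Algebra.Properties.CommutativeSemigroup *-commutativeSemigroup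
    using () renaming (x∙yz≈y∙xz to *-left-comm)
  open import Algebra.Properties.Semiring.Sum semiring
    using (sum; sum-cong-≋; sum-remove; sum-init-last; sum-replicate-zero; *-distribˡ-sum; *-distribʳ-sum)
  open import Relation.Binary.Reasoning.Setoid setoid

  -‿cong₂ : ∀ {x y u v} → x ≈ y → u ≈ v → x - u ≈ y - v
  -‿cong₂ x≈y u≈v = +-cong x≈y (-‿cong u≈v)

  ∑≡sum : ∀ {n} (f : Fin n → Carrier) → ∑ R f ≡ sum f
  ∑≡sum {ℕ.zero} f = ≡.refl
  ∑≡sum {suc n} f = ≡.cong (f zero +_) (∑≡sum (f ∘ suc))

  sum-neg : ∀ {n} (f : Fin n → Carrier) → sum (λ i → - f i) ≈ - sum f
  sum-neg {ℕ.zero} f = sym -0#≈0#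
  sum-neg {suc n} f = trans (+-congˡ (sum-neg (f ∘ suc))) (-‿+-comm _ _)

  sum-neg-*ʳ : ∀ {n} (f : Fin n → Carrier) (x : Carrier) →
    sum (λ i → - f i * x) ≈ - (sum f * x)
  sum-neg-*ʳ f x = begin
    sum (λ i → - f i * x)     ≈⟨ sum-cong-≋ (λ i → sym (-‿distribˡ-* (f i) x)) ⟩
    sum (λ i → - (f i * x))   ≈⟨ sum-neg (λ i → f i * x) ⟩
    - sum (λ i → f i * x)     ≈⟨ -‿cong (*-distribʳ-sum x f) ⟨
    - (sum f * x)             ∎

  sum-zero : ∀ {n} {f : Fin n → Carrier} → (∀ i → f i ≈ 0#) → sum f ≈ 0#
  sum-zero {n} f≈0 = trans (sum-cong-≋ f≈0) (sum-replicate-zero n)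

  ∑alt-cong : ∀ {n} {f g : Fin n → Carrier} → (∀ i → f i ≈ g i) → ∑alt R f ≈ ∑alt R g
  ∑alt-cong {ℕ.zero} f≈g = refl
  ∑alt-cong {suc n} f≈g = -‿cong₂ (f≈g zero) (∑alt-cong (f≈g ∘ suc))

  ∑alt-zero : ∀ {n} {f : Fin n → Carrier} → (∀ i → f i ≈ 0#) → ∑alt R f ≈ 0#
  ∑alt-zero {ℕ.zero} f≈0 = refl
  ∑alt-zero {suc n} f≈0 = trans (-‿cong₂ (f≈0 zero) (∑alt-zero (f≈0 ∘ suc))) (-‿inverseʳ 0#)

  ∑alt-distrib-+ : ∀ {n} (f g : Fin n → Carrier) →
    ∑alt R (λ i → f i + g i) ≈ ∑alt R f + ∑alt R g
  ∑alt-distrib-+ {ℕ.zero} f g = sym (+-identityʳ 0#)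
  ∑alt-distrib-+ {suc n} f g = begin
    (f zero + g zero) - ∑alt R (λ i → f (suc i) + g (suc i))
      ≈⟨ -‿cong₂ refl (∑alt-distrib-+ (f ∘ suc) (g ∘ suc)) ⟩
    (f zero + g zero) + - (∑alt R (f ∘ suc) + ∑alt R (g ∘ suc))
      ≈⟨ +-congˡ (sym (-‿+-comm _ _)) ⟩
    (f zero + g zero) + (- ∑alt R (f ∘ suc) + - ∑alt R (g ∘ suc))
      ≈⟨ +-interchange _ _ _ _ ⟩
    ∑alt R f + ∑alt R g ∎

  *-distribˡ-∑alt : ∀ {n} (a : Carrier) (f : Fin n → Carrier) →
    a * ∑alt R f ≈ ∑alt R (λ i → a * f i)
  *-distribˡ-∑alt {ℕ.zero} a f = zeroʳ a
  *-distribˡ-∑alt {suc n} a f =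
    trans (x[y-z]≈xy-xz a _ _) (-‿cong₂ refl (*-distribˡ-∑alt a (f ∘ suc)))

  ∑alt-linear : ∀ {n} (f g : Fin n → Carrier) (a : Carrier) →
    ∑alt R (λ i → f i + a * g i) ≈ ∑alt R f + a * ∑alt R g
  ∑alt-linear f g a =
    trans (∑alt-distrib-+ f (λ i → a * g i)) (+-congˡ (sym (*-distribˡ-∑alt a g)))

  sum-∑alt-comm : ∀ {m n} (h : Fin m → Fin n → Carrier) →
    sum (λ k → ∑alt R (h k)) ≈ ∑alt R (λ j → sum (λ k → h k j))
  sum-∑alt-comm {ℕ.zero} {n} h = sym (∑alt-zero {n} (λ _ → refl))
  sum-∑alt-comm {suc m} h =
    trans (+-congˡ (sum-∑alt-comm (h ∘ suc))) (sym (∑alt-distrib-+ (h zero) _))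

  ∑alt-cancel-adjacent : ∀ {n} (a : Fin n) (g : Fin (suc n) → Carrier) →
    g (inject₁ a) ≈ g (suc a) → (∀ j → j ≢ inject₁ a → j ≢ suc a → g j ≈ 0#) →
    ∑alt R g ≈ 0#
  ∑alt-cancel-adjacent zero g g₀≈g₁ rest≈0 = begin
    g zero - (g (suc zero) - ∑alt R (λ j → g (suc (suc j))))
      ≈⟨ -‿cong₂ g₀≈g₁ (-‿cong₂ refl (∑alt-zero (λ j → rest≈0 (suc (suc j)) (λ ()) (λ ())))) ⟩
    g (suc zero) - (g (suc zero) - 0#)
      ≈⟨ -‿cong₂ refl (trans (+-congˡ -0#≈0#) (+-identityʳ _)) ⟩
    g (suc zero) - g (suc zero)
      ≈⟨ -‿inverseʳ _ ⟩
    0# ∎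
  ∑alt-cancel-adjacent (suc a) g gₐ≈gₐ₊₁ rest≈0 = begin
    g zero - ∑alt R (g ∘ suc)
      ≈⟨ -‿cong₂ (rest≈0 zero (λ ()) (λ ())) (∑alt-cancel-adjacent a (g ∘ suc) gₐ≈gₐ₊₁ rest′≈0) ⟩
    0# - 0#
      ≈⟨ -‿inverseʳ 0# ⟩
    0# ∎
    where
    rest′≈0 : ∀ j → j ≢ inject₁ a → j ≢ suc a → g (suc j) ≈ 0#
    rest′≈0 j j≢a j≢a+1 = rest≈0 (suc j) (j≢a ∘ suc-injective) (j≢a+1 ∘ suc-injective)

  Matrix : ℕ → Set c
  Matrix n = Fin n → Fin n → Carrier

  minor : ∀ {n} → Matrix (suc n) → Fin (suc n) → Matrix n
  minor M j i k = M (suc i) (punchIn j k)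

  replaceRow : ∀ {n} → Fin n → Matrix n → Matrix n → Matrix n
  replaceRow k A B i j = if k =ᶠ i then B i j else A i j

  replaceCol : ∀ {n} → Fin n → Matrix n → Matrix n → Matrix n
  replaceCol l A B i j = if l =ᶠ j then B i j else A i j

  laplaceTerm : ∀ {n} → Matrix (suc n) → Fin (suc n) → Carrier
  laplaceTerm M j = M zero j * det R (minor M j)

  det-cong : ∀ {n} {M N : Matrix n} → (∀ i j → M i j ≈ N i j) → det R M ≈ det R N
  det-cong {ℕ.zero} M≈N = refl
  det-cong {suc n} M≈N =
    ∑alt-cong (λ j → *-cong (M≈N zero j) (det-cong (λ i k → M≈N (suc i) (punchIn j k))))

  det-replaceRow-self : ∀ {n} (k : Fin n) (A : Matrix n) → det R (replaceRow k A A) ≈ det R A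
  det-replaceRow-self k A = det-cong (λ i j → reflexive (if-eta (k =ᶠ i)))

  det-replaceRow-linear : ∀ {n} (k : Fin n) (A B C : Matrix n) (a : Carrier) →
    det R (replaceRow k A (λ i j → B i j + a * C i j))
      ≈ det R (replaceRow k A B) + a * det R (replaceRow k A C)
  det-replaceRow-linear {suc n} zero A B C a = begin
    ∑alt R (λ j → (B zero j + a * C zero j) * det R (minor A j))
      ≈⟨ ∑alt-cong (λ j → expand (B zero j) (C zero j) (det R (minor A j))) ⟩
    ∑alt R (λ j → B zero j * det R (minor A j) + a * (C zero j * det R (minor A j)))
      ≈⟨ ∑alt-linear (λ j → B zero j * det R (minor A j))
                     (λ j → C zero j * det R (minor A j)) a ⟩
    det R (replaceRow zero A B) + a * det R (replaceRow zero A C) ∎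
    where
    expand : ∀ x y d → (x + a * y) * d ≈ x * d + a * (y * d)
    expand x y d = trans (distribʳ d x (a * y)) (+-congˡ (*-assoc a y d))
  det-replaceRow-linear {suc n} (suc k) A B C a = begin
    ∑alt R (λ j → A zero j
                  * det R (replaceRow k (minor A j) (λ i l → minor B j i l + a * minor C j i l)))
      ≈⟨ ∑alt-cong (λ j → *-congˡ {A zero j}
           (det-replaceRow-linear k (minor A j) (minor B j) (minor C j) a)) ⟩
    ∑alt R (λ j → A zero j * (dB j + a * dC j))
      ≈⟨ ∑alt-cong (λ j → expand (A zero j) (dB j) (dC j)) ⟩
    ∑alt R (λ j → A zero j * dB j + a * (A zero j * dC j))
      ≈⟨ ∑alt-linear (λ j → A zero j * dB j) (λ j → A zero j * dC j) a ⟩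
    det R (replaceRow (suc k) A B) + a * det R (replaceRow (suc k) A C) ∎
    where
    dB dC : Fin (suc n) → Carrier
    dB j = det R (replaceRow k (minor A j) (minor B j))
    dC j = det R (replaceRow k (minor A j) (minor C j))
    expand : ∀ x d e → x * (d + a * e) ≈ x * d + a * (x * e)
    expand x d e = trans (distribˡ x d (a * e)) (+-congˡ (*-left-comm x a e))

  -- Deleting either of the two equal columns leaves the same minor, and the two
  -- Laplace terms enter the alternating sum with opposite signs; every other minor
  -- still contains two equal adjacent columns.
  det-adjacent-cols : ∀ {n} (M : Matrix (suc n)) (a : Fin n) →
    (∀ i → M i (inject₁ a) ≈ M i (suc a)) → det R M ≈ 0#
  det-adjacent-cols {suc n} M a cols≈ =
    ∑alt-cancel-adjacent a (laplaceTerm M) equal-terms other-terms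
    where
    minors≈ : ∀ i k → minor M (inject₁ a) i k ≈ minor M (suc a) i k
    minors≈ i k with punchIn-inject₁-suc a k
    ... | inj₁ eq = reflexive (≡.cong (M (suc i)) eq)
    ... | inj₂ (eq₁ , eq₂) = begin
      M (suc i) (punchIn (inject₁ a) k)  ≡⟨ ≡.cong (M (suc i)) eq₁ ⟩
      M (suc i) (suc a)                  ≈⟨ cols≈ (suc i) ⟨
      M (suc i) (inject₁ a)              ≡⟨ ≡.cong (M (suc i)) eq₂ ⟨
      M (suc i) (punchIn (suc a) k)      ∎
    equal-terms : laplaceTerm M (inject₁ a) ≈ laplaceTerm M (suc a)
    equal-terms = *-cong (cols≈ zero) (det-cong minors≈)
    other-terms : ∀ j → j ≢ inject₁ a → j ≢ suc a → laplaceTerm M j ≈ 0#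
    other-terms j j≢a j≢a+1 with punchIn-adjacent-preimage a j j≢a j≢a+1
    ... | b , eq₁ , eq₂ = trans (*-congˡ (det-adjacent-cols (minor M j) b cols′)) (zeroʳ _)
      where
      cols′ : ∀ i → minor M j i (inject₁ b) ≈ minor M j i (suc b)
      cols′ i = begin
        M (suc i) (punchIn j (inject₁ b))  ≡⟨ ≡.cong (M (suc i)) eq₁ ⟩
        M (suc i) (inject₁ a)              ≈⟨ cols≈ (suc i) ⟩
        M (suc i) (suc a)                  ≡⟨ ≡.cong (M (suc i)) eq₂ ⟨
        M (suc i) (punchIn j (suc b))      ∎

  minor-replaceCol-self : ∀ {n} (j : Fin (suc n)) (A B : Matrix (suc n)) i k →
    minor (replaceCol j A B) j i k ≡ minor A j i k
  minor-replaceCol-self j A B i k rewrite =ᶠ-≢ (punchInᵢ≢i j k ∘ ≡.sym) = ≡.refl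

  minor-replaceCol-punchIn : ∀ {n} (j : Fin (suc n)) (l : Fin n) (A B : Matrix (suc n)) i k →
    minor (replaceCol (punchIn j l) A B) j i k ≡ replaceCol l (minor A j) (minor B j) i k
  minor-replaceCol-punchIn j l A B i k rewrite punchIn-=ᶠ j l k = ≡.refl

  sum-laplaceTerm-replaceCol : ∀ {n} (A B : Matrix (suc n)) (j : Fin (suc n)) →
    sum (λ l → laplaceTerm (replaceCol l A B) j)
      ≈ B zero j * det R (minor A j)
        + A zero j * sum (λ l → det R (replaceCol l (minor A j) (minor B j)))
  sum-laplaceTerm-replaceCol {n} A B j = begin
    sum T
      ≈⟨ sum-remove {i = j} T ⟩
    T j + sum (λ l → T (punchIn j l))
      ≈⟨ +-cong T-at-j (sum-cong-≋ T-off-j) ⟩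
    B zero j * det R (minor A j) + sum (λ l → A zero j * colMinorDet l)
      ≈⟨ +-congˡ (*-distribˡ-sum (A zero j) colMinorDet) ⟨
    B zero j * det R (minor A j) + A zero j * sum colMinorDet ∎
    where
    T : Fin (suc n) → Carrier
    T l = laplaceTerm (replaceCol l A B) j
    colMinorDet : Fin n → Carrier
    colMinorDet l = det R (replaceCol l (minor A j) (minor B j))
    T-at-j : T j ≈ B zero j * det R (minor A j)
    T-at-j rewrite =ᶠ-refl j = *-congˡ (det-cong (λ i k → reflexive (minor-replaceCol-self j A B i k)))
    T-off-j : ∀ l → T (punchIn j l) ≈ A zero j * colMinorDet l
    T-off-j l rewrite =ᶠ-≢ (punchInᵢ≢i j l) =
      *-congˡ (det-cong (λ i k → reflexive (minor-replaceCol-punchIn j l A B i k)))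

  sum-det-replaceRow≈sum-det-replaceCol : ∀ {n} (A B : Matrix n) →
    sum (λ k → det R (replaceRow k A B)) ≈ sum (λ l → det R (replaceCol l A B))
  sum-det-replaceRow≈sum-det-replaceCol {ℕ.zero} A B = refl
  sum-det-replaceRow≈sum-det-replaceCol {suc n} A B = begin
    ∑alt R rowTerm + sum (λ k → ∑alt R (λ j → A zero j * rowMinorDet k j))
      ≈⟨ +-congˡ (sum-∑alt-comm (λ k j → A zero j * rowMinorDet k j)) ⟩
    ∑alt R rowTerm + ∑alt R (λ j → sum (λ k → A zero j * rowMinorDet k j))
      ≈⟨ +-congˡ (∑alt-cong columnwise) ⟩
    ∑alt R rowTerm + ∑alt R (λ j → A zero j * colMinorSum j)
      ≈⟨ ∑alt-distrib-+ rowTerm (λ j → A zero j * colMinorSum j) ⟨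
    ∑alt R (λ j → rowTerm j + A zero j * colMinorSum j)
      ≈⟨ ∑alt-cong (sum-laplaceTerm-replaceCol A B) ⟨
    ∑alt R (λ j → sum (λ l → laplaceTerm (replaceCol l A B) j))
      ≈⟨ sum-∑alt-comm (λ l → laplaceTerm (replaceCol l A B)) ⟨
    sum (λ l → det R (replaceCol l A B)) ∎
    where
    rowTerm : Fin (suc n) → Carrier
    rowTerm j = B zero j * det R (minor A j)
    rowMinorDet : Fin n → Fin (suc n) → Carrier
    rowMinorDet k j = det R (replaceRow k (minor A j) (minor B j))
    colMinorSum : Fin (suc n) → Carrier
    colMinorSum j = sum (λ l → det R (replaceCol l (minor A j) (minor B j)))
    columnwise : ∀ j → sum (λ k → A zero j * rowMinorDet k j) ≈ A zero j * colMinorSum j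
    columnwise j = begin
      sum (λ k → A zero j * rowMinorDet k j)
        ≈⟨ *-distribˡ-sum (A zero j) (λ k → rowMinorDet k j) ⟨
      A zero j * sum (λ k → rowMinorDet k j)
        ≈⟨ *-congˡ (sum-det-replaceRow≈sum-det-replaceCol (minor A j) (minor B j)) ⟩
      A zero j * colMinorSum j ∎

  initCols tailCols : ∀ {m} → (Fin m → Fin (suc m) → Carrier) → Matrix m
  initCols u i j = u i (inject₁ j)
  tailCols u i j = u i (suc j)

  sum-det-replaceCol-tailCols : ∀ {m} (u : Fin (suc m) → Fin (suc (suc m)) → Carrier) →
    sum (λ l → det R (replaceCol l (initCols u) (tailCols u)))
      ≈ det R (λ i j → u i (if fromℕ m =ᶠ j then suc j else inject₁ j))
  sum-det-replaceCol-tailCols {m} u = begin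
    sum (λ l → det R (replaceCol l U U′))
      ≈⟨ sum-init-last (λ l → det R (replaceCol l U U′)) ⟩
    sum (λ l → det R (replaceCol (inject₁ l) U U′)) + det R (replaceCol (fromℕ m) U U′)
      ≈⟨ +-cong (sum-zero {f = λ l → det R (replaceCol (inject₁ l) U U′)} inner-vanish) last-col ⟩
    0# + det R (λ i j → u i (if fromℕ m =ᶠ j then suc j else inject₁ j))
      ≈⟨ +-identityˡ _ ⟩
    det R (λ i j → u i (if fromℕ m =ᶠ j then suc j else inject₁ j)) ∎
    where
    U U′ : Matrix (suc m)
    U = initCols u
    U′ = tailCols u
    repeated-col : ∀ l i →
      replaceCol (inject₁ l) U U′ i (inject₁ l) ≈ replaceCol (inject₁ l) U U′ i (suc l)
    repeated-col l i rewrite =ᶠ-refl (inject₁ l) | =ᶠ-≢ (inject₁≢suc l) = refl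
    inner-vanish : ∀ l → det R (replaceCol (inject₁ l) U U′) ≈ 0#
    inner-vanish l = det-adjacent-cols (replaceCol (inject₁ l) U U′) l (repeated-col l)
    last-col : det R (replaceCol (fromℕ m) U U′)
             ≈ det R (λ i j → u i (if fromℕ m =ᶠ j then suc j else inject₁ j))
    last-col = det-cong (λ i j →
      reflexive (≡.sym (if-float (u i) (fromℕ m =ᶠ j) {suc j} {inject₁ j})))

  shiftRowPerturbed : ∀ {m} → (Fin (suc m) → Fin (suc (suc m)) → Carrier) →
    (Fin (suc m) → Carrier) → Fin (suc m) → Matrix (suc m)
  shiftRowPerturbed u p k i j =
    u i (if k =ᶠ i then suc j else inject₁ j) - p i * u i (inject₁ j) * ⟦_⟧ R (k =ᶠ i)

  det-shiftRowPerturbed : ∀ {m} (u : Fin (suc m) → Fin (suc (suc m)) → Carrier)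
    (p : Fin (suc m) → Carrier) k →
    det R (shiftRowPerturbed u p k)
      ≈ det R (replaceRow k (initCols u) (tailCols u)) + - p k * det R (initCols u)
  det-shiftRowPerturbed u p k = begin
    det R (shiftRowPerturbed u p k)
      ≈⟨ det-cong entry ⟩
    det R (replaceRow k (initCols u) (λ i j → tailCols u i j + - p k * initCols u i j))
      ≈⟨ det-replaceRow-linear k (initCols u) (tailCols u) (initCols u) (- p k) ⟩
    det R (replaceRow k (initCols u) (tailCols u))
      + - p k * det R (replaceRow k (initCols u) (initCols u))
      ≈⟨ +-congˡ (*-congˡ (det-replaceRow-self k (initCols u))) ⟩
    det R (replaceRow k (initCols u) (tailCols u)) + - p k * det R (initCols u) ∎
    where
    entry : ∀ i j →
      shiftRowPerturbed u p k i j
        ≈ replaceRow k (initCols u) (λ i j → tailCols u i j + - p k * initCols u i j) i j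
    entry i j with k =ᶠ i | proof (k F.≟ i)
    ... | true | ofʸ ≡.refl = +-congˡ (trans (-‿cong (*-identityʳ _)) (-‿distribˡ-* _ _))
    ... | false | ofⁿ _ = trans (+-congˡ (trans (-‿cong (zeroʳ _)) -0#≈0#)) (+-identityʳ _)

lemma9p6 : {c ℓ : Level} (R : CommutativeRing c ℓ) (m : ℕ)
           (u : Fin (suc m) → Fin (suc (suc m)) → CommutativeRing.Carrier R)
           (p : Fin (suc m) → CommutativeRing.Carrier R) →
           let open CommutativeRing R in
           ∑ R (λ k → det R (λ i j →
               u i (if k =ᶠ i then suc j else inject₁ j)
               - p i * u i (inject₁ j) * ⟦_⟧ R (k =ᶠ i)))
           ≈ det R (λ i j → u i (if fromℕ m =ᶠ j then suc j else inject₁ j))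
             - ∑ R p * det R (λ i j → u i (inject₁ j))
lemma9p6 R m u p = begin
  ∑ R (λ k → det R (shiftRowPerturbed R u p k))
    ≡⟨ ∑≡sum R (λ k → det R (shiftRowPerturbed R u p k)) ⟩
  sum (λ k → det R (shiftRowPerturbed R u p k))
    ≈⟨ sum-cong-≋ (det-shiftRowPerturbed R u p) ⟩
  sum (λ k → det R (replaceRow R k U U′) + - p k * det R U)
    ≈⟨ ∑-distrib-+ (λ k → det R (replaceRow R k U U′)) (λ k → - p k * det R U) ⟩
  sum (λ k → det R (replaceRow R k U U′)) + sum (λ k → - p k * det R U)
    ≈⟨ +-cong (sum-det-replaceRow≈sum-det-replaceCol R U U′) (sum-neg-*ʳ R p (det R U)) ⟩
  sum (λ l → det R (replaceCol R l U U′)) - sum p * det R U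
    ≈⟨ -‿cong₂ R (sum-det-replaceCol-tailCols R u)
                 (reflexive (≡.cong (_* det R U) (≡.sym (∑≡sum R p)))) ⟩
  det R (λ i j → u i (if fromℕ m =ᶠ j then suc j else inject₁ j)) - ∑ R p * det R U ∎
  where
  open CommutativeRing R
  open import Algebra.Properties.Semiring.Sum semiring using (sum; sum-cong-≋; ∑-distrib-+)
  open import Relation.Binary.Reasoning.Setoid setoid
  U U′ : Matrix R (suc m)
  U = initCols R u
  U′ = tailCols R u
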